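{- Let $G=(V,E)$ be a directed graph with propagation probabilities $p:V\times V\to[0,1]$ and let $A\subseteq V$. Then the set function $S\mapsto \sigma(A,S)$, defined on subsets $S\subseteq (A\times V)\setminus E$, is monotonically increasing (i.e. $\sigma(A,S)\le\sigma(A,T)$ whenever $S\subseteq T$) and submodular, i.e. for all $S\subseteq T\subseteq (A\times V)\setminus E$ and every $e\in (A\times V)\setminus (E\cup T)$, $$\sigma(A,S\cup\{e\})-\sigma(A,S)\ \ge\ \sigma(A,T\cup\{e\})-\sigma(A,T).$$
   Context: Independent Cascade Model (ICM): given a seed set $A\subseteq V$, the nodes of $A$ are active at the start; in discrete steps, each node $u$ that has just become active gets exactly one chance to activate each currently inactive out-neighbour $v$, succeeding independently with probability $p_{(u,v)}$; the process stops when no new node becomes active. Equivalently, each edge $e$ is declared "live" independently with probability $p_e$, and the final active set is the set of nodes reachable from $A$ by paths of live edges. For $S\subseteq (V\times V)\setminus E$, let $G(S)=(V,E\cup S)$ (new edges carry the probabilities given by $p$), and let $\sigma(A,S)$ be the expected number of active nodes at the end of the ICM process on $G(S)$ with seed set $A$. -}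

module Defs where

open import Level using (Level; _⊔_; suc)
open import Data.Nat using (ℕ; zero) renaming (suc to sucℕ; _+_ to _+ℕ_)
open import Data.Fin using (Fin; _≟_)
open import Relation.Nullary using (yes; no)
open import Data.Bool using (Bool; true; false; _∨_; _∧_; if_then_else_)
open import Data.Vec.Functional using (_∷_)
open import Relation.Binary.PropositionalEquality using (_≡_)
open import Relation.Binary.Structures using (IsPartialOrder)
open import Algebra.Bundles using (CommutativeRing)
import Algebra.Bundles
import Algebra.Definitions.RawSemiring as RSDefs
open import Data.Product using (_×_)

-- Ordered commutative rings (the reals are an instance).  Probabilities
-- and expectations are taken in such a ring R.

record OrderedCommRing (c ℓ ℓ′ : Level) : Set (suc (c ⊔ ℓ ⊔ ℓ′)) where
  field
    commRing : CommutativeRing c ℓ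
  open CommutativeRing commRing public
  field
    _≤_        : Carrier → Carrier → Set ℓ′
    isPartialOrder : IsPartialOrder _≈_ _≤_
    +-mono-≤   : ∀ {a b} c → a ≤ b → (a + c) ≤ (b + c)
    *-nonneg   : ∀ {a b} → 0# ≤ a → 0# ≤ b → 0# ≤ (a * b)

-- Finite directed graphs on V = Fin n; edge sets are relations Fin n → Fin n → Bool.

Rel₂ : ℕ → Set
Rel₂ n = Fin n → Fin n → Bool

VSet : ℕ → Set
VSet n = Fin n → Bool

_∪ᴱ_ : ∀ {n} → Rel₂ n → Rel₂ n → Rel₂ n
(S ∪ᴱ T) u v = S u v ∨ T u v

_⊆ᴱ_ : ∀ {n} → Rel₂ n → Rel₂ n → Set
S ⊆ᴱ T = ∀ u v → S u v ≡ true → T u v ≡ true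

Admissible : ∀ {n} → VSet n → Rel₂ n → Rel₂ n → Set
Admissible A E S = ∀ u v → S u v ≡ true → (A u ≡ true) × (E u v ≡ false)

-- Reachability: nodes reachable from A via edges of L
-- (n rounds of one-step expansion suffice on n nodes).

anyFin : (k : ℕ) → (Fin k → Bool) → Bool
anyFin zero    f = false
anyFin (sucℕ k) f = f Fin.zero ∨ anyFin k (λ i → f (Fin.suc i))

step : ∀ {n} → Rel₂ n → VSet n → VSet n
step {n} L R v = R v ∨ anyFin n (λ u → R u ∧ L u v)

iter : ∀ {n} → ℕ → Rel₂ n → VSet n → VSet n
iter zero     L R = R
iter (sucℕ k) L R = step L (iter k L R)

reach : ∀ {n} → Rel₂ n → VSet n → VSet n
reach {n} L A = iter n L A

count : (k : ℕ) → (Fin k → Bool) → ℕ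
count zero     f = 0
count (sucℕ k) f = (if f Fin.zero then 1 else 0) +ℕ count k (λ i → f (Fin.suc i))

module Spread {c ℓ ℓ′} (R : OrderedCommRing c ℓ ℓ′) where
  open OrderedCommRing R
  open RSDefs (Algebra.Bundles.Semiring.rawSemiring semiring) using () renaming (_×_ to _·ℕ_)

  sumFun : ∀ {X : Set} (k : ℕ) → ((X → Carrier) → Carrier) → ((Fin k → X) → Carrier) → Carrier
  sumFun zero     sumX F = F (λ ())
  sumFun (sucℕ k) sumX F = sumX (λ x → sumFun k sumX (λ g → F (x ∷ g)))

  sumBool : (Bool → Carrier) → Carrier
  sumBool f = f true + f false

  sumRel : (n : ℕ) → (Rel₂ n → Carrier) → Carrier
  sumRel n = sumFun n (sumFun n sumBool)

  prodFin : (k : ℕ) → (Fin k → Carrier) → Carrier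
  prodFin zero     f = 1#
  prodFin (sucℕ k) f = f Fin.zero * prodFin k (λ i → f (Fin.suc i))

  -- probability that the live-edge set equals L, in the graph with edge set F:
  -- each edge e of F is live independently with probability p e, non-edges are never live.
  edgeWeight : Carrier → Bool → Bool → Carrier
  edgeWeight q true  true  = q
  edgeWeight q true  false = 1# - q
  edgeWeight q false true  = 0#
  edgeWeight q false false = 1#

  weight : ∀ {n} → (Fin n → Fin n → Carrier) → Rel₂ n → Rel₂ n → Carrier
  weight {n} p F L = prodFin n (λ u → prodFin n (λ v → edgeWeight (p u v) (F u v) (L u v)))

  -- σ(A,S): expected number of active nodes of ICM on G(S) = (V, E ∪ S) with seeds A
  σ : ∀ {n} → Rel₂ n → (Fin n → Fin n → Carrier) → VSet n → Rel₂ n → Carrier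
  σ {n} E p A S = sumRel n (λ L → weight p (E ∪ᴱ S) L * (count n (reach L A) ·ℕ 1#))

open Spread public

single : ∀ {n} → Fin n → Fin n → Rel₂ n
single {n} a b u v with a ≟ u | b ≟ v
... | yes _ | yes _ = true
... | _ | _ = false

module Submission where

-- The proof couples all graphs through one live-edge set.  If F ⊆ G, then
-- drawing the live edges L of G and keeping L ∩ F gives exactly the live-edge
-- distribution of F (lemma `thinning`).  So σ(A,S), σ(A,T), σ(A,S+e) and
-- σ(A,T+e) are all expectations, over the live edges L of the largest graph
-- E ∪ T ∪ {e}, of the number of nodes reachable from A along L ∩ F for the
-- respective F (lemma `σ-as-expectation`).  Expectations against the
-- non-negative live-edge weights are monotone, so both claims reduce to
-- statements about reachability for one fixed L:
--   * monotonicity: reachability is monotone in the edge set;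
--   * submodularity: every node newly reached when e is added to E ∪ T is
--     already reached when e is added to E ∪ S, because e and all edges of T
--     leave seeds, which are reached from the start (lemma `newly-reached`);
--     a nodewise count then gives |R(T+e)| + |R(S)| ≤ |R(S+e)| + |R(T)|.

open import Defs
open import Level using (_⊔_)
open import Data.Nat using (ℕ; zero; z≤n; s≤s) renaming (suc to sucℕ; _+_ to _+ℕ_; _≤_ to _≤ℕ_)
import Data.Nat.Properties as ℕP
open import Data.Fin using (Fin; _≟_) renaming (zero to fzero; suc to fsuc)
open import Data.Bool using (Bool; true; false; _∨_; _∧_; if_then_else_)
open import Data.Bool.Properties using (¬-not)
open import Data.Product using (_×_; _,_; proj₁; proj₂; Σ-syntax; uncurry; map₁)
open import Data.Sum using (_⊎_; inj₁; inj₂; [_,_]) renaming (map to map-⊎; map₁ to map₁-⊎)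
open import Data.Empty using (⊥-elim)
open import Data.Vec.Functional using (_∷_)
open import Relation.Binary.PropositionalEquality using (_≡_; _≢_; refl; sym; trans; cong; cong₂; subst; subst₂)
open import Relation.Nullary using (yes; no)
open import Relation.Binary.Structures using (IsPartialOrder)
import Algebra.Bundles
import Algebra.Definitions.RawSemiring as RawSemiringDefs
import Algebra.Properties.Monoid.Mult as MonoidMult
import Algebra.Properties.CommutativeSemigroup as CommSemigroupProps

∨-elim : ∀ x {y} → x ∨ y ≡ true → x ≡ true ⊎ y ≡ true
∨-elim true  _ = inj₁ refl
∨-elim false p = inj₂ p

∨-introˡ : ∀ {x} y → x ≡ true → x ∨ y ≡ true
∨-introˡ _ refl = refl

∨-introʳ : ∀ x {y} → y ≡ true → x ∨ y ≡ true
∨-introʳ true  _ = refl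
∨-introʳ false p = p

∧-elim : ∀ x {y} → x ∧ y ≡ true → x ≡ true × y ≡ true
∧-elim true p = refl , p

∨-false : ∀ x {y} → x ∨ y ≡ false → x ≡ false × y ≡ false
∨-false false p = refl , p

∧-intro : ∀ {x y} → x ≡ true → y ≡ true → x ∧ y ≡ true
∧-intro refl refl = refl

true≢false : true ≢ false
true≢false ()

anyFin-witness : ∀ k f → anyFin k f ≡ true → Σ[ i ∈ Fin k ] f i ≡ true
anyFin-witness (sucℕ k) f p with ∨-elim (f fzero) p
... | inj₁ f0 = fzero , f0
... | inj₂ rest with anyFin-witness k (λ i → f (fsuc i)) rest
...   | i , fi = fsuc i , fi

anyFin-intro : ∀ k f (i : Fin k) → f i ≡ true → anyFin k f ≡ true
anyFin-intro (sucℕ k) f fzero    fi = ∨-introˡ _ fi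
anyFin-intro (sucℕ k) f (fsuc i) fi = ∨-introʳ (f fzero) (anyFin-intro k (λ j → f (fsuc j)) i fi)

indicator : Bool → ℕ
indicator b = if b then 1 else 0

-- Without function extensionality, search and counting must be shown to
-- respect pointwise equality of their arguments.

anyFin-cong : ∀ k f g → (∀ i → f i ≡ g i) → anyFin k f ≡ anyFin k g
anyFin-cong zero     f g f≗g = refl
anyFin-cong (sucℕ k) f g f≗g =
  cong₂ _∨_ (f≗g fzero) (anyFin-cong k _ _ (λ i → f≗g (fsuc i)))

count-cong : ∀ k f g → (∀ i → f i ≡ g i) → count k f ≡ count k g
count-cong zero     f g f≗g = refl
count-cong (sucℕ k) f g f≗g =
  cong₂ (λ b m → indicator b +ℕ m) (f≗g fzero) (count-cong k _ _ (λ i → f≗g (fsuc i)))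

module _ {n : ℕ} where

  _∩ᴱ_ : Rel₂ n → Rel₂ n → Rel₂ n
  (L ∩ᴱ F) u v = L u v ∧ F u v

  _≐_ : Rel₂ n → Rel₂ n → Set
  L ≐ L′ = ∀ u v → L u v ≡ L′ u v

  ⊆-trans : ∀ {S T U : Rel₂ n} → S ⊆ᴱ T → T ⊆ᴱ U → S ⊆ᴱ U
  ⊆-trans S⊆T T⊆U u v s = T⊆U u v (S⊆T u v s)

  ∪-inˡ : ∀ (S T : Rel₂ n) → S ⊆ᴱ (S ∪ᴱ T)
  ∪-inˡ S T u v s = ∨-introˡ (T u v) s

  ∪-inʳ : ∀ (S T : Rel₂ n) → T ⊆ᴱ (S ∪ᴱ T)
  ∪-inʳ S T u v t = ∨-introʳ (S u v) t

  ∪-lub : ∀ {S T U : Rel₂ n} → S ⊆ᴱ U → T ⊆ᴱ U → (S ∪ᴱ T) ⊆ᴱ U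
  ∪-lub {S} S⊆U T⊆U u v st = [ S⊆U u v , T⊆U u v ] (∨-elim (S u v) st)

  ∪-monoʳ : ∀ (E : Rel₂ n) {S T} → S ⊆ᴱ T → (E ∪ᴱ S) ⊆ᴱ (E ∪ᴱ T)
  ∪-monoʳ E {S} {T} S⊆T = ∪-lub (∪-inˡ E T) (⊆-trans S⊆T (∪-inʳ E T))

  ∩-monoʳ : ∀ (L : Rel₂ n) {F F′} → F ⊆ᴱ F′ → (L ∩ᴱ F) ⊆ᴱ (L ∩ᴱ F′)
  ∩-monoʳ L F⊆F′ u v lf with ∧-elim (L u v) lf
  ... | l , f = ∧-intro l (F⊆F′ u v f)

  ∩-⊆ˡ : ∀ (L F : Rel₂ n) → (L ∩ᴱ F) ⊆ᴱ L
  ∩-⊆ˡ L F u v lf = proj₁ (∧-elim (L u v) lf)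

  single-source : ∀ (a b u v : Fin n) → single a b u v ≡ true → a ≡ u
  single-source a b u v with a ≟ u | b ≟ v
  ... | yes a≡u | yes _ = λ _ → a≡u
  ... | yes _   | no _  = λ ()
  ... | no _    | _     = λ ()

module _ {n : ℕ} where

  iter-seed : ∀ k (L : Rel₂ n) (A : VSet n) v → A v ≡ true → iter k L A v ≡ true
  iter-seed zero     L A v seed = seed
  iter-seed (sucℕ k) L A v seed = ∨-introˡ _ (iter-seed k L A v seed)

  iter-mono : ∀ k {L L′ : Rel₂ n} A → L ⊆ᴱ L′ → ∀ v → iter k L A v ≡ true → iter k L′ A v ≡ true
  iter-mono zero     A L⊆L′ v r = r
  iter-mono (sucℕ k) {L} {L′} A L⊆L′ v r with ∨-elim (iter k L A v) r
  ... | inj₁ earlier = ∨-introˡ _ (iter-mono k A L⊆L′ v earlier)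
  ... | inj₂ viaEdge with anyFin-witness n _ viaEdge
  ...   | u , uv with ∧-elim (iter k L A u) uv
  ...     | ru , luv = ∨-introʳ (iter k L′ A v)
                         (anyFin-intro n _ u (∧-intro (iter-mono k A L⊆L′ u ru) (L⊆L′ u v luv)))

  iter-cong : ∀ k {L L′ : Rel₂ n} A → L ≐ L′ → ∀ v → iter k L A v ≡ iter k L′ A v
  iter-cong zero     A L≐L′ v = refl
  iter-cong (sucℕ k) A L≐L′ v =
    cong₂ _∨_ (iter-cong k A L≐L′ v)
      (anyFin-cong n _ _ (λ u → cong₂ _∧_ (iter-cong k A L≐L′ u) (L≐L′ u v)))

  -- Think of X ⊆ X′ as the live edges of E ∪ S
  -- and E ∪ S ∪ {e}, and of Y, Y′ as those of E ∪ T and E ∪ T ∪ {e}: every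
  -- Y′-edge is a Y-edge or an X′-edge leaving a seed, and every Y-edge is an
  -- X-edge or leaves a seed.
  newly-reached : ∀ k (A : VSet n) {X X′ Y Y′ : Rel₂ n} → X ⊆ᴱ X′
    → (∀ u v → Y′ u v ≡ true → Y u v ≡ true ⊎ (X′ u v ≡ true × A u ≡ true))
    → (∀ u v → Y u v ≡ true → X u v ≡ true ⊎ A u ≡ true)
    → ∀ v → iter k Y′ A v ≡ true → iter k Y A v ≡ false → iter k X′ A v ≡ true
  newly-reached zero A X⊆X′ Y′-edge Y-edge v inY′ notY = inY′
  newly-reached (sucℕ k) A {X} {X′} {Y} {Y′} X⊆X′ Y′-edge Y-edge v inY′ notY =
    [ (λ earlier → ∨-introˡ _ (IH v earlier (proj₁ (∨-false _ notY))))
    , (λ viaEdge → let (u , uv) = anyFin-witness n _ viaEdge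
                       (inY′ᵤ , y′uv) = ∧-elim (iter k Y′ A u) uv
                   in ∨-introʳ _ (anyFin-intro n _ u (uncurry ∧-intro (transfer u inY′ᵤ y′uv)))) ]
    (∨-elim (iter k Y′ A v) inY′)
    where
    IH : ∀ v → iter k Y′ A v ≡ true → iter k Y A v ≡ false → iter k X′ A v ≡ true
    IH = newly-reached k A X⊆X′ Y′-edge Y-edge

    noYEdge : anyFin n (λ u → iter k Y A u ∧ Y u v) ≡ false
    noYEdge = proj₂ (∨-false _ notY)

    transfer : ∀ u → iter k Y′ A u ≡ true → Y′ u v ≡ true → iter k X′ A u ≡ true × X′ u v ≡ true
    transfer u inY′ᵤ y′uv with Y′-edge u v y′uv
    ... | inj₂ (x′uv , seedᵤ) = iter-seed k X′ A u seedᵤ , x′uv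
    ... | inj₁ yuv =
      [ (λ xuv → IH u inY′ᵤ (¬-not notYᵤ) , X⊆X′ u v xuv)
      , (λ seedᵤ → ⊥-elim (notYᵤ (iter-seed k Y A u seedᵤ))) ] (Y-edge u v yuv)
      where
      notYᵤ : iter k Y A u ≢ true
      notYᵤ inYᵤ = true≢false (trans (sym (anyFin-intro n _ u (∧-intro inYᵤ yuv))) noYEdge)

indicator-mono : ∀ c d → (c ≡ true → d ≡ true) → indicator c ≤ℕ indicator d
indicator-mono true  d c⇒d with c⇒d refl
... | refl = s≤s z≤n
indicator-mono false d c⇒d = z≤n

count-mono : ∀ k (c d : Fin k → Bool) → (∀ i → c i ≡ true → d i ≡ true) → count k c ≤ℕ count k d
count-mono zero     c d c⇒d = z≤n
count-mono (sucℕ k) c d c⇒d =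
  ℕP.+-mono-≤ (indicator-mono (c fzero) (d fzero) (c⇒d fzero)) (count-mono k _ _ (λ i → c⇒d (fsuc i)))

-- Here q, c, p, d stand for membership in the
-- sets reached in E ∪ T ∪ {e}, E ∪ S, E ∪ S ∪ {e} and E ∪ T.
indicator-exchange : ∀ q c p d → (c ≡ true → p ≡ true) → (c ≡ true → d ≡ true)
  → (q ≡ true → d ≡ false → p ≡ true) → indicator q +ℕ indicator c ≤ℕ indicator p +ℕ indicator d
indicator-exchange q true p d c⇒p c⇒d _ with c⇒p refl | c⇒d refl
... | refl | refl = ℕP.+-monoˡ-≤ 1 (indicator-mono q true (λ _ → refl))
indicator-exchange false false p d _ _ _ = z≤n
indicator-exchange true  false p true  _ _ _ = ℕP.m≤n+m 1 (indicator p)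
indicator-exchange true  false p false _ _ q∖d⇒p with q∖d⇒p refl refl
... | refl = s≤s z≤n

count-exchange : ∀ k (q c p d : Fin k → Bool)
  → (∀ i → c i ≡ true → p i ≡ true) → (∀ i → c i ≡ true → d i ≡ true)
  → (∀ i → q i ≡ true → d i ≡ false → p i ≡ true)
  → count k q +ℕ count k c ≤ℕ count k p +ℕ count k d
count-exchange zero     q c p d _ _ _ = z≤n
count-exchange (sucℕ k) q c p d c⇒p c⇒d q∖d⇒p =
  subst₂ _≤ℕ_ (interchange (indicator (q fzero)) (indicator (c fzero)) _ _)
              (interchange (indicator (p fzero)) (indicator (d fzero)) _ _)
    (ℕP.+-mono-≤ (indicator-exchange (q fzero) (c fzero) (p fzero) (d fzero) (c⇒p fzero) (c⇒d fzero) (q∖d⇒p fzero))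
                 (count-exchange k _ _ _ _ (λ i → c⇒p (fsuc i)) (λ i → c⇒d (fsuc i)) (λ i → q∖d⇒p (fsuc i))))
  where open CommSemigroupProps ℕP.+-commutativeSemigroup using (interchange)

module OrderedRingFacts {c ℓ ℓ′} (R : OrderedCommRing c ℓ ℓ′) where
  open OrderedCommRing R renaming (refl to ≈-refl; sym to ≈-sym; trans to ≈-trans)
  open IsPartialOrder isPartialOrder public
    using (≲-respˡ-≈; ≲-respʳ-≈) renaming (refl to ≤-refl; trans to ≤-trans)
  open RawSemiringDefs (Algebra.Bundles.Semiring.rawSemiring semiring) using () renaming (_×_ to _·ℕ_)
  open import Relation.Binary.Reasoning.Setoid setoid

  +-monoʳ-≤ : ∀ {a b} x → a ≤ b → (x + a) ≤ (x + b)
  +-monoʳ-≤ {a} {b} x a≤b = ≲-respˡ-≈ (+-comm a x) (≲-respʳ-≈ (+-comm b x) (+-mono-≤ x a≤b))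

  +-mono₂-≤ : ∀ {a b x y} → a ≤ b → x ≤ y → (a + x) ≤ (b + y)
  +-mono₂-≤ {b = b} {x} a≤b x≤y = ≤-trans (+-mono-≤ x a≤b) (+-monoʳ-≤ b x≤y)

  nonneg-+ : ∀ {a b} → 0# ≤ a → 0# ≤ b → 0# ≤ (a + b)
  nonneg-+ 0≤a 0≤b = ≲-respˡ-≈ (+-identityˡ 0#) (+-mono₂-≤ 0≤a 0≤b)

  nonneg-− : ∀ {a b} → a ≤ b → 0# ≤ (b - a)
  nonneg-− {a} a≤b = ≲-respˡ-≈ (-‿inverseʳ a) (+-mono-≤ (- a) a≤b)

  −+-cancel : ∀ x y → ((x - y) + y) ≈ x
  −+-cancel x y = begin
    (x - y) + y   ≈⟨ +-assoc x (- y) y ⟩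
    x + (- y + y) ≈⟨ +-cong ≈-refl (-‿inverseˡ y) ⟩
    x + 0#        ≈⟨ +-identityʳ x ⟩
    x             ∎

  *-monoˡ-≤ : ∀ {w a b} → 0# ≤ w → a ≤ b → (w * a) ≤ (w * b)
  *-monoˡ-≤ {w} {a} {b} 0≤w a≤b =
    ≲-respˡ-≈ (+-identityˡ (w * a))
      (≲-respʳ-≈ w[b−a]+wa≈wb (+-mono-≤ (w * a) (*-nonneg 0≤w (nonneg-− a≤b))))
    where
    w[b−a]+wa≈wb : (w * (b - a) + w * a) ≈ (w * b)
    w[b−a]+wa≈wb = begin
      w * (b - a) + w * a ≈⟨ ≈-sym (distribˡ w (b - a) a) ⟩
      w * ((b - a) + a)   ≈⟨ *-cong ≈-refl (−+-cancel b a) ⟩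
      w * b               ∎

  -- Submodularity is proved in the form b + x ≤ a + y and converted to differences.
  sum-to-difference : ∀ {a b x y} → (b + x) ≤ (a + y) → (b - y) ≤ (a - x)
  sum-to-difference {a} {b} {x} {y} h = ≲-respˡ-≈ lhs (≲-respʳ-≈ rhs (+-mono-≤ (- y + - x) h))
    where
    cancel : ∀ s t r → (s + (t + (- t + r))) ≈ (s + r)
    cancel s t r = +-cong ≈-refl (begin
      t + (- t + r) ≈⟨ ≈-sym (+-assoc t (- t) r) ⟩
      (t - t) + r   ≈⟨ +-cong (-‿inverseʳ t) ≈-refl ⟩
      0# + r        ≈⟨ +-identityˡ r ⟩
      r             ∎)
    lhs : ((b + x) + (- y + - x)) ≈ (b - y)
    lhs = begin
      (b + x) + (- y + - x) ≈⟨ +-cong ≈-refl (+-comm (- y) (- x)) ⟩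
      (b + x) + (- x + - y) ≈⟨ +-assoc b x _ ⟩
      b + (x + (- x + - y)) ≈⟨ cancel b x (- y) ⟩
      b - y                 ∎
    rhs : ((a + y) + (- y + - x)) ≈ (a - x)
    rhs = ≈-trans (+-assoc a y _) (cancel a y (- x))

  ·ℕ-nonneg : 0# ≤ 1# → ∀ m → 0# ≤ (m ·ℕ 1#)
  ·ℕ-nonneg 0≤1 zero     = ≤-refl
  ·ℕ-nonneg 0≤1 (sucℕ m) = nonneg-+ 0≤1 (·ℕ-nonneg 0≤1 m)

  ·ℕ-mono : 0# ≤ 1# → ∀ {m m′} → m ≤ℕ m′ → (m ·ℕ 1#) ≤ (m′ ·ℕ 1#)
  ·ℕ-mono 0≤1 {m′ = m′} z≤n = ·ℕ-nonneg 0≤1 m′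
  ·ℕ-mono 0≤1 (s≤s m≤m′)    = +-monoʳ-≤ 1# (·ℕ-mono 0≤1 m≤m′)

module LiveEdgeSums {c ℓ ℓ′} (R : OrderedCommRing c ℓ ℓ′) where
  open OrderedCommRing R renaming (refl to ≈-refl; sym to ≈-sym; trans to ≈-trans)
  open OrderedRingFacts R
  open Spread R using ()
    renaming (sumFun to ∑ᶠ; sumBool to ∑ᴮ; sumRel to ∑ᴿ; prodFin to ∏; edgeWeight to edgeW; weight to wt)
  open import Relation.Binary.Reasoning.Setoid setoid

  record Summation (X : Set) : Set (c ⊔ ℓ ⊔ ℓ′) where
    field
      sum       : (X → Carrier) → Carrier
      sum-cong  : ∀ f g → (∀ x → f x ≈ g x) → sum f ≈ sum g
      sum-+     : ∀ f g → sum (λ x → f x + g x) ≈ (sum f + sum g)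
      sum-scale : ∀ a f → sum (λ x → a * f x) ≈ (a * sum f)
      sum-mono  : ∀ f g → (∀ x → f x ≤ g x) → sum f ≤ sum g
  open Summation

  bool-summation : Summation Bool
  bool-summation = record
    { sum       = ∑ᴮ
    ; sum-cong  = λ f g f≈g → +-cong (f≈g true) (f≈g false)
    ; sum-+     = λ f g → interchange (f true) (g true) (f false) (g false)
    ; sum-scale = λ a f → ≈-sym (distribˡ a (f true) (f false))
    ; sum-mono  = λ f g f≤g → +-mono₂-≤ (f≤g true) (f≤g false)
    }
    where open CommSemigroupProps +-commutativeSemigroup using (interchange)

  module _ {X : Set} (Σx : Summation X) where

    private
      ∑ₖ : ∀ k → ((Fin k → X) → Carrier) → Carrier
      ∑ₖ k = ∑ᶠ k (sum Σx)

    fun-sum-cong : ∀ k (f g : (Fin k → X) → Carrier) → (∀ x → f x ≈ g x) → ∑ₖ k f ≈ ∑ₖ k g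
    fun-sum-cong zero     f g f≈g = f≈g _
    fun-sum-cong (sucℕ k) f g f≈g = sum-cong Σx _ _ (λ x → fun-sum-cong k _ _ (λ h → f≈g (x ∷ h)))

    fun-sum-+ : ∀ k (f g : (Fin k → X) → Carrier) → ∑ₖ k (λ x → f x + g x) ≈ (∑ₖ k f + ∑ₖ k g)
    fun-sum-+ zero     f g = ≈-refl
    fun-sum-+ (sucℕ k) f g = ≈-trans (sum-cong Σx _ _ (λ x → fun-sum-+ k _ _)) (sum-+ Σx _ _)

    fun-sum-scale : ∀ k a (f : (Fin k → X) → Carrier) → ∑ₖ k (λ x → a * f x) ≈ (a * ∑ₖ k f)
    fun-sum-scale zero     a f = ≈-refl
    fun-sum-scale (sucℕ k) a f = ≈-trans (sum-cong Σx _ _ (λ x → fun-sum-scale k a _)) (sum-scale Σx a _)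

    fun-sum-mono : ∀ k (f g : (Fin k → X) → Carrier) → (∀ x → f x ≤ g x) → ∑ₖ k f ≤ ∑ₖ k g
    fun-sum-mono zero     f g f≤g = f≤g _
    fun-sum-mono (sucℕ k) f g f≤g = sum-mono Σx _ _ (λ x → fun-sum-mono k _ _ (λ h → f≤g (x ∷ h)))

    fun-summation : ∀ k → Summation (Fin k → X)
    fun-summation k = record
      { sum = ∑ₖ k ; sum-cong = fun-sum-cong k ; sum-+ = fun-sum-+ k
      ; sum-scale = fun-sum-scale k ; sum-mono = fun-sum-mono k }

    -- Pushforward of a product measure under a coordinatewise map.
    pushforward-product : (_~_ : X → X → Set) → (∀ x → x ~ x)
      → (k : ℕ) (wG wF : Fin k → X → Carrier) (r : Fin k → X → X)
      → (∀ i (φ : X → Carrier) → (∀ x y → x ~ y → φ x ≈ φ y)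
           → sum Σx (λ x → wG i x * φ (r i x)) ≈ sum Σx (λ x → wF i x * φ x))
      → (h : (Fin k → X) → Carrier) → (∀ f g → (∀ i → f i ~ g i) → h f ≈ h g)
      → ∑ₖ k (λ L → ∏ k (λ i → wG i (L i)) * h (λ i → r i (L i)))
        ≈ ∑ₖ k (λ L → ∏ k (λ i → wF i (L i)) * h L)
    pushforward-product _~_ ~-refl zero wG wF r coord h h-cong = *-cong ≈-refl (h-cong _ _ (λ ()))
    pushforward-product _~_ ~-refl (sucℕ k) wG wF r coord h h-cong =
      ≈-trans (sum-cong Σx _ _ push-tail) (≈-trans (coord fzero φ φ-cong) (sum-cong Σx _ _ regroup))
      where
      ∏G ∏F : (Fin k → X) → Carrier
      ∏G g = ∏ k (λ i → wG (fsuc i) (g i))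
      ∏F g = ∏ k (λ i → wF (fsuc i) (g i))

      cons-cong : ∀ {y y′} {g g′ : Fin k → X} → y ~ y′ → (∀ i → g i ~ g′ i)
        → h (y ∷ g) ≈ h (y′ ∷ g′)
      cons-cong y~y′ g~g′ = h-cong _ _ (λ { fzero → y~y′ ; (fsuc i) → g~g′ i })

      φ : X → Carrier
      φ y = ∑ₖ k (λ g → ∏F g * h (y ∷ g))

      φ-cong : ∀ x y → x ~ y → φ x ≈ φ y
      φ-cong x y x~y = fun-sum-cong k _ _ (λ g → *-cong ≈-refl (cons-cong x~y (λ i → ~-refl (g i))))

      push-tail : ∀ x → ∑ₖ k (λ g → (wG fzero x * ∏G g) * h (λ i → r i ((x ∷ g) i)))
                        ≈ (wG fzero x * φ (r fzero x))
      push-tail x = begin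
        ∑ₖ k (λ g → (wG fzero x * ∏G g) * h (λ i → r i ((x ∷ g) i)))
          ≈⟨ fun-sum-cong k _ _ (λ g → ≈-trans (*-assoc _ _ _)
               (*-cong ≈-refl (*-cong ≈-refl (h-cong _ _ (λ { fzero → ~-refl _ ; (fsuc i) → ~-refl _ }))))) ⟩
        ∑ₖ k (λ g → wG fzero x * (∏G g * h (r fzero x ∷ (λ i → r (fsuc i) (g i)))))
          ≈⟨ fun-sum-scale k _ _ ⟩
        wG fzero x * ∑ₖ k (λ g → ∏G g * h (r fzero x ∷ (λ i → r (fsuc i) (g i))))
          ≈⟨ *-cong ≈-refl (pushforward-product _~_ ~-refl k (λ i → wG (fsuc i)) (λ i → wF (fsuc i))
                (λ i → r (fsuc i)) (λ i → coord (fsuc i)) (λ g → h (r fzero x ∷ g))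
                (λ g g′ g~g′ → cons-cong (~-refl _) g~g′)) ⟩
        wG fzero x * φ (r fzero x) ∎

      regroup : ∀ x → (wF fzero x * φ x) ≈ ∑ₖ k (λ g → (wF fzero x * ∏F g) * h (x ∷ g))
      regroup x = ≈-trans (≈-sym (fun-sum-scale k _ _)) (fun-sum-cong k _ _ (λ g → ≈-sym (*-assoc _ _ _)))

  edge-thinning : ∀ q (g f : Bool) → (f ≡ true → g ≡ true) → (φ : Bool → Carrier)
    → ∑ᴮ (λ x → edgeW q g x * φ (x ∧ f)) ≈ ∑ᴮ (λ x → edgeW q f x * φ x)
  edge-thinning q true  true  _ φ = ≈-refl
  edge-thinning q true  false _ φ = begin
    q * φ false + (1# - q) * φ false ≈⟨ ≈-sym (distribʳ (φ false) q (1# - q)) ⟩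
    (q + (1# - q)) * φ false         ≈⟨ *-cong (≈-trans (+-comm q (1# - q)) (−+-cancel 1# q)) ≈-refl ⟩
    1# * φ false                     ≈⟨ ≈-sym (+-identityˡ _) ⟩
    0# + 1# * φ false                ≈⟨ +-cong (≈-sym (zeroˡ _)) ≈-refl ⟩
    0# * φ true + 1# * φ false       ∎
  edge-thinning q false true  f⇒g φ with f⇒g refl
  ... | ()
  edge-thinning q false false _ φ = +-cong (≈-trans (zeroˡ _) (≈-sym (zeroˡ _))) ≈-refl

  module _ (n : ℕ) (p : Fin n → Fin n → Carrier) where

    rel-summation : Summation (Rel₂ n)
    rel-summation = fun-summation (fun-summation bool-summation n) n

    expectation : Rel₂ n → (Rel₂ n → Carrier) → Carrier
    expectation G h = ∑ᴿ n (λ L → wt p G L * h L)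

    thinning : ∀ (F G : Rel₂ n) → F ⊆ᴱ G
      → (h : Rel₂ n → Carrier) → (∀ L L′ → L ≐ L′ → h L ≈ h L′)
      → expectation G (λ L → h (L ∩ᴱ F)) ≈ expectation F h
    thinning F G F⊆G h h-cong =
      pushforward-product (fun-summation bool-summation n) (λ r r′ → ∀ v → r v ≡ r′ v) (λ _ _ → refl) n
        (λ u row → ∏ n (λ v → edgeW (p u v) (G u v) (row v)))
        (λ u row → ∏ n (λ v → edgeW (p u v) (F u v) (row v)))
        (λ u row v → row v ∧ F u v)
        (λ u φ φ-cong → pushforward-product bool-summation _≡_ (λ _ → refl) n
            (λ v → edgeW (p u v) (G u v)) (λ v → edgeW (p u v) (F u v)) (λ v b → b ∧ F u v)
            (λ v ψ _ → edge-thinning (p u v) (G u v) (F u v) (F⊆G u v) ψ) φ φ-cong)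
        h h-cong

    expectation-+ : ∀ G h₁ h₂ → expectation G (λ L → h₁ L + h₂ L) ≈ (expectation G h₁ + expectation G h₂)
    expectation-+ G h₁ h₂ =
      ≈-trans (sum-cong rel-summation _ _ (λ L → distribˡ _ _ _)) (sum-+ rel-summation _ _)

    module _ (p-prob : ∀ u v → (0# ≤ p u v) × (p u v ≤ 1#)) (0≤1 : 0# ≤ 1#) where

      ∏-nonneg : ∀ k f → (∀ i → 0# ≤ f i) → 0# ≤ ∏ k f
      ∏-nonneg zero     f _     = 0≤1
      ∏-nonneg (sucℕ k) f f≥0 = *-nonneg (f≥0 fzero) (∏-nonneg k _ (λ i → f≥0 (fsuc i)))

      edgeW-nonneg : ∀ q → 0# ≤ q → q ≤ 1# → ∀ g x → 0# ≤ edgeW q g x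
      edgeW-nonneg q 0≤q q≤1 true  true  = 0≤q
      edgeW-nonneg q 0≤q q≤1 true  false = nonneg-− q≤1
      edgeW-nonneg q 0≤q q≤1 false true  = ≤-refl
      edgeW-nonneg q 0≤q q≤1 false false = 0≤1

      weight-nonneg : ∀ G L → 0# ≤ wt p G L
      weight-nonneg G L = ∏-nonneg n _ (λ u → ∏-nonneg n _ (λ v →
        edgeW-nonneg (p u v) (proj₁ (p-prob u v)) (proj₂ (p-prob u v)) (G u v) (L u v)))

      expectation-mono : ∀ G h₁ h₂ → (∀ L → h₁ L ≤ h₂ L) → expectation G h₁ ≤ expectation G h₂
      expectation-mono G h₁ h₂ h₁≤h₂ =
        sum-mono rel-summation _ _ (λ L → *-monoˡ-≤ (weight-nonneg G L) (h₁≤h₂ L))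

module SpreadProperties {c ℓ ℓ′} (R : OrderedCommRing c ℓ ℓ′) (n : ℕ) (E : Rel₂ n)
    (p : Fin n → Fin n → OrderedCommRing.Carrier R)
    (p-prob : ∀ u v → OrderedCommRing._≤_ R (OrderedCommRing.0# R) (p u v)
                    × OrderedCommRing._≤_ R (p u v) (OrderedCommRing.1# R))
    (0≤1 : OrderedCommRing._≤_ R (OrderedCommRing.0# R) (OrderedCommRing.1# R))
    (A : VSet n) where
  open OrderedCommRing R renaming (refl to ≈-refl; sym to ≈-sym; trans to ≈-trans)
  open OrderedRingFacts R
  open LiveEdgeSums R
  open RawSemiringDefs (Algebra.Bundles.Semiring.rawSemiring semiring) using () renaming (_×_ to _·ℕ_)
  open MonoidMult +-monoid using (×-homo-+)

  spread : Rel₂ n → Carrier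
  spread L = count n (reach L A) ·ℕ 1#

  spread-cong : ∀ L L′ → L ≐ L′ → spread L ≈ spread L′
  spread-cong L L′ L≐L′ = reflexive (cong (_·ℕ 1#) (count-cong n _ _ (iter-cong n A L≐L′)))

  spread-mono : ∀ {L L′} → L ⊆ᴱ L′ → spread L ≤ spread L′
  spread-mono L⊆L′ = ·ℕ-mono 0≤1 (count-mono n _ _ (iter-mono n A L⊆L′))

  σ-as-expectation : ∀ F G → (E ∪ᴱ F) ⊆ᴱ G
    → expectation n p G (λ L → spread (L ∩ᴱ (E ∪ᴱ F))) ≈ σ R E p A F
  σ-as-expectation F G EF⊆G = thinning n p (E ∪ᴱ F) G EF⊆G spread spread-cong

  σ-mono : ∀ S T → S ⊆ᴱ T → σ R E p A S ≤ σ R E p A T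
  σ-mono S T S⊆T =
    ≲-respˡ-≈ (σ-as-expectation S (E ∪ᴱ T) (∪-monoʳ E S⊆T))
      (expectation-mono n p p-prob 0≤1 (E ∪ᴱ T) _ _ (λ L → spread-mono (∩-⊆ˡ L _)))

  module _ (S T : Rel₂ n) (a b : Fin n) (T-adm : Admissible A E T) (S⊆T : S ⊆ᴱ T) (a-seed : A a ≡ true) where

    e : Rel₂ n
    e = single a b

    GS GSe GT GTe : Rel₂ n
    GS  = E ∪ᴱ S
    GSe = E ∪ᴱ (S ∪ᴱ e)
    GT  = E ∪ᴱ T
    GTe = E ∪ᴱ (T ∪ᴱ e)

    GS⊆GSe : GS ⊆ᴱ GSe
    GS⊆GSe = ∪-monoʳ E (∪-inˡ S e)

    GS⊆GT : GS ⊆ᴱ GT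
    GS⊆GT = ∪-monoʳ E S⊆T

    GSe⊆GTe : GSe ⊆ᴱ GTe
    GSe⊆GTe = ∪-monoʳ E (∪-lub (⊆-trans S⊆T (∪-inˡ T e)) (∪-inʳ T e))

    GT⊆GTe : GT ⊆ᴱ GTe
    GT⊆GTe = ∪-monoʳ E (∪-inˡ T e)

    GTe-edge : ∀ u v → GTe u v ≡ true → GT u v ≡ true ⊎ (GSe u v ≡ true × A u ≡ true)
    GTe-edge u v uv with ∨-elim (E u v) uv
    ... | inj₁ Euv = inj₁ (∪-inˡ E T u v Euv)
    ... | inj₂ Teuv with ∨-elim (T u v) Teuv
    ...   | inj₁ Tuv = inj₁ (∪-inʳ E T u v Tuv)
    ...   | inj₂ euv = inj₂ ( ⊆-trans (∪-inʳ S e) (∪-inʳ E (S ∪ᴱ e)) u v euv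
                          , subst (λ w → A w ≡ true) (single-source a b u v euv) a-seed )

    GT-edge : ∀ u v → GT u v ≡ true → GS u v ≡ true ⊎ A u ≡ true
    GT-edge u v uv with ∨-elim (E u v) uv
    ... | inj₁ Euv = inj₁ (∪-inˡ E S u v Euv)
    ... | inj₂ Tuv = inj₂ (proj₁ (T-adm u v Tuv))

    spread-exchange : ∀ L
      → (spread (L ∩ᴱ GTe) + spread (L ∩ᴱ GS)) ≤ (spread (L ∩ᴱ GSe) + spread (L ∩ᴱ GT))
    spread-exchange L =
      ≲-respˡ-≈ (×-homo-+ 1# (count n (reach Y′ A)) (count n (reach X A)))
        (≲-respʳ-≈ (×-homo-+ 1# (count n (reach X′ A)) (count n (reach Y A)))
          (·ℕ-mono 0≤1 (count-exchange n (reach Y′ A) (reach X A) (reach X′ A) (reach Y A)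
            (iter-mono n A (∩-monoʳ L GS⊆GSe)) (iter-mono n A (∩-monoʳ L GS⊆GT))
            (newly-reached n A (∩-monoʳ L GS⊆GSe) Y′-edge Y-edge))))
      where
      X X′ Y Y′ : Rel₂ n
      X  = L ∩ᴱ GS
      X′ = L ∩ᴱ GSe
      Y  = L ∩ᴱ GT
      Y′ = L ∩ᴱ GTe
      Y′-edge : ∀ u v → Y′ u v ≡ true → Y u v ≡ true ⊎ (X′ u v ≡ true × A u ≡ true)
      Y′-edge u v Y′uv with ∧-elim (L u v) Y′uv
      ... | l , uv = map-⊎ (∧-intro l) (map₁ (∧-intro l)) (GTe-edge u v uv)
      Y-edge : ∀ u v → Y u v ≡ true → X u v ≡ true ⊎ A u ≡ true
      Y-edge u v Yuv with ∧-elim (L u v) Yuv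
      ... | l , uv = map₁-⊎ (∧-intro l) (GT-edge u v uv)

    σ-submodular : (σ R E p A (T ∪ᴱ e) - σ R E p A T) ≤ (σ R E p A (S ∪ᴱ e) - σ R E p A S)
    σ-submodular =
      sum-to-difference
        (≲-respˡ-≈ (joint (T ∪ᴱ e) S (λ _ _ uv → uv) (⊆-trans GS⊆GT GT⊆GTe))
          (≲-respʳ-≈ (joint (S ∪ᴱ e) T GSe⊆GTe GT⊆GTe)
            (expectation-mono n p p-prob 0≤1 GTe _ _ spread-exchange)))
      where
      joint : ∀ F F′ → (E ∪ᴱ F) ⊆ᴱ GTe → (E ∪ᴱ F′) ⊆ᴱ GTe
        → expectation n p GTe (λ L → spread (L ∩ᴱ (E ∪ᴱ F)) + spread (L ∩ᴱ (E ∪ᴱ F′)))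
          ≈ (σ R E p A F + σ R E p A F′)
      joint F F′ EF⊆GTe EF′⊆GTe = ≈-trans (expectation-+ n p GTe _ _)
        (+-cong (σ-as-expectation F GTe EF⊆GTe) (σ-as-expectation F′ GTe EF′⊆GTe))

-- The theorem.  With no nodes, σ(A,S) does not depend on S; otherwise any
-- probability p u v ∈ [0,1] witnesses 0 ≤ 1, which the spread bounds need.
theorem4 : ∀ {c ℓ ℓ′} (R : OrderedCommRing c ℓ ℓ′) (n : ℕ)
    (E : Rel₂ n) (p : Fin n → Fin n → OrderedCommRing.Carrier R)
    → (∀ u v → OrderedCommRing._≤_ R (OrderedCommRing.0# R) (p u v)
             × OrderedCommRing._≤_ R (p u v) (OrderedCommRing.1# R))
    → (A : VSet n)
    → (∀ (S T : Rel₂ n) → Admissible A E S → Admissible A E T → S ⊆ᴱ T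
         → OrderedCommRing._≤_ R (σ R E p A S) (σ R E p A T))
      × (∀ (S T : Rel₂ n) (a b : Fin n) → Admissible A E S → Admissible A E T → S ⊆ᴱ T
         → A a ≡ true → E a b ≡ false → T a b ≡ false
         → OrderedCommRing._≤_ R
             (OrderedCommRing._-_ R (σ R E p A (T ∪ᴱ single a b)) (σ R E p A T))
             (OrderedCommRing._-_ R (σ R E p A (S ∪ᴱ single a b)) (σ R E p A S)))
theorem4 R zero E p p-prob A =
  (λ _ _ _ _ _ → ≤-refl) , (λ _ _ _ _ _ _ _ _ _ _ → ≤-refl)
  where open OrderedRingFacts R using (≤-refl)
theorem4 R (sucℕ m) E p p-prob A =
  (λ S T _ _ S⊆T → σ-mono S T S⊆T) ,
  (λ S T a b _ T-adm S⊆T a-seed _ _ → σ-submodular S T a b T-adm S⊆T a-seed)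
  where
  0≤1 : OrderedCommRing._≤_ R (OrderedCommRing.0# R) (OrderedCommRing.1# R)
  0≤1 = OrderedRingFacts.≤-trans R (proj₁ (p-prob fzero fzero)) (proj₂ (p-prob fzero fzero))
  open SpreadProperties R (sucℕ m) E p p-prob 0≤1 A using (σ-mono; σ-submodular)
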